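{- Let $\mathcal U$ be a variety of closure algebras satisfying the McKinsey identity and containing $\mathsf B(\mathbf 2^2\oplus\mathbf 1)$, let $\mathcal W$ be a variety of monadic algebras, and let $\mathcal V=\mathcal U\vee\mathcal W$ be their varietal join with free algebra $\mathbf F_{\mathcal V}$ of countably infinite rank. Then $\mathbf 4^2$ does not embed into $\mathbf F_{\mathcal V}$.
   Context: A closure algebra is a Boolean algebra with unary $\Diamond$ satisfying $\Diamond0=0$, $\Diamond(a\vee b)=\Diamond a\vee\Diamond b$, $a\le\Diamond a=\Diamond\Diamond a$; $\Box x=\neg\Diamond\neg x$; it is monadic if $\Diamond\Box a=\Box a$ for all $a$. The McKinsey identity is $(\forall x)\,\neg\Box\Diamond x\vee\Diamond\Box x\approx1$. $\mathsf B(\mathbf 2^2\oplus\mathbf 1)$ is the closure algebra of all subsets of the poset $\{r,p,q\}$ with $r<p$, $r<q$, where $\Diamond X=\{y:\ y\le x\text{ for some }x\in X\}$. $\mathbf 4$ is the four-element closure algebra with atoms $a,\neg a$ where $\Diamond0=0$, $\Diamond a=1$, $\Diamond\neg a=\neg a$, $\Diamond1=1$ (so $a$ is open but not closed and $\neg a$ is closed but not open). -}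

module Defs where

open import Data.Nat using (ℕ)
open import Data.Bool using (Bool; true; false; _∨_; _∧_; not)
open import Data.Product using (_×_; _,_)
open import Relation.Binary.PropositionalEquality using (_≡_)

infixr 6 _∧'_
infixr 5 _∨'_

data Term : Set where
  var        : ℕ → Term
  ⊥' ⊤'      : Term
  _∨'_ _∧'_  : Term → Term → Term
  ¬'_ ◇'_    : Term → Term

□'_ : Term → Term
□' t = ¬' (◇' (¬' t))

record Alg : Set₁ where
  field
    Carrier : Set
    zero one : Carrier
    join meet : Carrier → Carrier → Carrier
    neg dia : Carrier → Carrier

eval : (A : Alg) → (ℕ → Alg.Carrier A) → Term → Alg.Carrier A
eval A ρ (var i)  = ρ i
eval A ρ ⊥'       = Alg.zero A
eval A ρ ⊤'       = Alg.one A
eval A ρ (s ∨' t) = Alg.join A (eval A ρ s) (eval A ρ t)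
eval A ρ (s ∧' t) = Alg.meet A (eval A ρ s) (eval A ρ t)
eval A ρ (¬' s)   = Alg.neg A (eval A ρ s)
eval A ρ (◇' s)   = Alg.dia A (eval A ρ s)

_⊨_≈_ : Alg → Term → Term → Set
A ⊨ s ≈ t = ∀ (ρ : ℕ → Alg.Carrier A) → eval A ρ s ≡ eval A ρ t

private
  x y z : Term
  x = var 0
  y = var 1
  z = var 2

data CAAxiom : Term → Term → Set where
  ∨-comm   : CAAxiom (x ∨' y) (y ∨' x)
  ∧-comm   : CAAxiom (x ∧' y) (y ∧' x)
  ∨-assoc  : CAAxiom ((x ∨' y) ∨' z) (x ∨' (y ∨' z))
  ∧-assoc  : CAAxiom ((x ∧' y) ∧' z) (x ∧' (y ∧' z))
  ∨-absorb : CAAxiom (x ∨' (x ∧' y)) x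
  ∧-absorb : CAAxiom (x ∧' (x ∨' y)) x
  ∧-distr  : CAAxiom (x ∧' (y ∨' z)) ((x ∧' y) ∨' (x ∧' z))
  ∨-distr  : CAAxiom (x ∨' (y ∧' z)) ((x ∨' y) ∧' (x ∨' z))
  ∨-compl  : CAAxiom (x ∨' (¬' x)) ⊤'
  ∧-compl  : CAAxiom (x ∧' (¬' x)) ⊥'
  ◇-zero   : CAAxiom (◇' ⊥') ⊥'
  ◇-join   : CAAxiom (◇' (x ∨' y)) ((◇' x) ∨' (◇' y))
  ◇-infl   : CAAxiom (x ∨' (◇' x)) (◇' x)
  ◇-idem   : CAAxiom (◇' (◇' x)) (◇' x)

IsClosureAlgebra : Alg → Set
IsClosureAlgebra A = ∀ {s t} → CAAxiom s t → A ⊨ s ≈ t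

Identities : Set₁
Identities = Term → Term → Set

_∈V_ : Alg → Identities → Set
A ∈V Σ = IsClosureAlgebra A × (∀ {s t} → Σ s t → A ⊨ s ≈ t)

_⊫_≈_ : Identities → Term → Term → Set₁
Σ ⊫ s ≈ t = ∀ (A : Alg) → A ∈V Σ → A ⊨ s ≈ t

McKinsey : Identities → Set₁
McKinsey Σ = Σ ⊫ ((¬' (□' (◇' x))) ∨' (◇' (□' x))) ≈ ⊤'

Monadic : Identities → Set₁
Monadic Σ = Σ ⊫ (◇' (□' x)) ≈ (□' x)

-- Equational theory of the varietal join U ∨ W (the variety generated
-- by U ∪ W): identities valid in every member of U and of W.
JoinTh : Identities → Identities → Term → Term → Set₁
JoinTh ΣU ΣW s t = (ΣU ⊫ s ≈ t) × (ΣW ⊫ s ≈ t)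

-- B(2² ⊕ 1): subsets (r , p , q) of {r,p,q}, r < p, r < q,
-- ◇X = down-set of X.

B2²⊕1 : Alg
B2²⊕1 = record
  { Carrier = Bool × Bool × Bool
  ; zero = false , false , false
  ; one  = true , true , true
  ; join = λ { (a , b , c) (a' , b' , c') → (a ∨ a') , (b ∨ b') , (c ∨ c') }
  ; meet = λ { (a , b , c) (a' , b' , c') → (a ∧ a') , (b ∧ b') , (c ∧ c') }
  ; neg  = λ { (a , b , c) → not a , not b , not c }
  ; dia  = λ { (r , p , q) → (r ∨ p ∨ q) , p , q }
  }

-- 4: atoms a and ¬a; element (u , v) = "contains a" , "contains ¬a".
-- ◇a = 1, ◇¬a = ¬a.
Four : Set
Four = Bool × Bool

diaFour : Four → Four
diaFour (u , v) = u , (u ∨ v)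

Four² : Set
Four² = Four × Four

module F² where
  𝟘 𝟙 : Four²
  𝟘 = (false , false) , (false , false)
  𝟙 = (true , true) , (true , true)
  _⊔_ _⊓_ : Four² → Four² → Four²
  ((a , b) , (c , d)) ⊔ ((a' , b') , (c' , d')) = ((a ∨ a') , (b ∨ b')) , ((c ∨ c') , (d ∨ d'))
  ((a , b) , (c , d)) ⊓ ((a' , b') , (c' , d')) = ((a ∧ a') , (b ∧ b')) , ((c ∧ c') , (d ∧ d'))
  ∁ ◆ : Four² → Four²
  ∁ ((a , b) , (c , d)) = (not a , not b) , (not c , not d)
  ◆ (u , w) = diaFour u , diaFour w

-- Embedding of 4² into the free algebra F_V of countably infinite rank
-- (terms over ℕ modulo the equational theory ~ of V).

record EmbedsInto (_~_ : Term → Term → Set₁) : Set₁ where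
  open F²
  field
    f      : Four² → Term
    pres-0 : f 𝟘 ~ ⊥'
    pres-1 : f 𝟙 ~ ⊤'
    pres-∨ : ∀ a b → f (a ⊔ b) ~ (f a ∨' f b)
    pres-∧ : ∀ a b → f (a ⊓ b) ~ (f a ∧' f b)
    pres-¬ : ∀ a → f (∁ a) ~ (¬' f a)
    pres-◇ : ∀ a → f (◆ a) ~ (◇' f a)
    inj    : ∀ a b → f a ~ f b → a ≡ b

-- E₀ = (1 , 0) is clopen in 4², so if f embeds 4² into F_V then t = f E₀ is a term that is
-- clopen in every algebra of U. Valuations in B(2²⊕1) whose root is 0 evaluate t at the two
-- maximal points independently; connectedness forces the values to agree, so t read as a
-- Boolean term (◇ erased) is constant. In a McKinsey algebra, □ p ∨ □ ¬ p is dense open for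
-- every p, and on the meet of these over the ◇-subterms of t the operator ◇ acts trivially, so
-- a closed term that is a Boolean tautology equals 1. Hence U ⊨ t ≈ 1 or U ⊨ ¬ t ≈ 1; say the
-- first. The element X = (1 , a) lies above E₀, so U ⊨ f X ≈ 1; and X is open and dense, while
-- in the monadic W open elements are closed, so W ⊨ f X ≈ ◇ f X ≈ f 1. Thus f X = f 1 in F_V
-- although X ≠ 1. The second case is symmetric, with ∁ E₀ and (a , 1).

module Submission where

open import Defs hiding (∨-comm; ∧-comm; ∨-assoc; ∧-assoc; ◇-idem)
open import Relation.Nullary using (¬_; yes; no; contradiction)

open import Algebra.Consequences.Propositional using (comm∧distrˡ⇒distr; comm∧invʳ⇒inv)
open import Algebra.Lattice.Bundles using (BooleanAlgebra)
import Algebra.Lattice.Properties.BooleanAlgebra as BooleanAlgebraProperties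
open import Data.Bool using (Bool; true; false; not) renaming (_∨_ to _or_; _∧_ to _and_)
open import Data.List using (List; []; _∷_; _++_)
open import Data.List.Membership.Propositional using (_∈_)
open import Data.List.Membership.Propositional.Properties using (∈-++⁺ˡ; ∈-++⁺ʳ)
open import Data.List.Relation.Unary.Any using (here; there)
open import Data.Nat using (ℕ; suc)
open import Data.Nat.Properties using (_≟_)
open import Data.Product using (_×_; _,_; proj₁; proj₂)
open import Data.Sum using (_⊎_; inj₁; inj₂; [_,_]′)
open import Function using (id; _∘_; case_of_)
open import Level using (0ℓ)
open import Relation.Binary.PropositionalEquality

record IsHomomorphism (A B : Alg) (h : Alg.Carrier A → Alg.Carrier B) : Set where
  field
    zero-hom : h (Alg.zero A) ≡ Alg.zero B
    one-hom  : h (Alg.one A) ≡ Alg.one B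
    join-hom : ∀ a b → h (Alg.join A a b) ≡ Alg.join B (h a) (h b)
    meet-hom : ∀ a b → h (Alg.meet A a b) ≡ Alg.meet B (h a) (h b)
    neg-hom  : ∀ a → h (Alg.neg A a) ≡ Alg.neg B (h a)
    dia-hom  : ∀ a → h (Alg.dia A a) ≡ Alg.dia B (h a)

eval-homomorphic : ∀ {A B h} → IsHomomorphism A B h →
                   ∀ ρ t → h (eval A ρ t) ≡ eval B (h ∘ ρ) t
eval-homomorphic hom ρ (var i)  = refl
eval-homomorphic hom ρ ⊥'       = IsHomomorphism.zero-hom hom
eval-homomorphic hom ρ ⊤'       = IsHomomorphism.one-hom hom
eval-homomorphic {B = B} hom ρ (s ∨' t) =
  trans (IsHomomorphism.join-hom hom _ _)
        (cong₂ (Alg.join B) (eval-homomorphic hom ρ s) (eval-homomorphic hom ρ t))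
eval-homomorphic {B = B} hom ρ (s ∧' t) =
  trans (IsHomomorphism.meet-hom hom _ _)
        (cong₂ (Alg.meet B) (eval-homomorphic hom ρ s) (eval-homomorphic hom ρ t))
eval-homomorphic {B = B} hom ρ (¬' s) =
  trans (IsHomomorphism.neg-hom hom _) (cong (Alg.neg B) (eval-homomorphic hom ρ s))
eval-homomorphic {B = B} hom ρ (◇' s) =
  trans (IsHomomorphism.dia-hom hom _) (cong (Alg.dia B) (eval-homomorphic hom ρ s))

discrete : Alg → Alg
discrete A = record A { dia = id }

𝟚 : Alg
𝟚 = record
  { Carrier = Bool ; zero = false ; one = true
  ; join = _or_ ; meet = _and_ ; neg = not ; dia = id
  }

Tautology : Term → Set
Tautology t = ∀ v → eval 𝟚 v t ≡ true

vars : Term → List ℕ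
vars (var i)  = i ∷ []
vars ⊥'       = []
vars ⊤'       = []
vars (s ∨' t) = vars s ++ vars t
vars (s ∧' t) = vars s ++ vars t
vars (¬' s)   = vars s
vars (◇' s)   = vars s

update : (ℕ → Bool) → ℕ → Bool → ℕ → Bool
update v k b i with i ≟ k
... | yes _ = b
... | no _  = v i

module ClosureAlgebra (A : Alg) (isCA : IsClosureAlgebra A) where

  open Alg A public
    renaming ( zero to ⊥; one to ⊤; join to infixr 6 _∨_; meet to infixr 7 _∧_
             ; neg to infixr 8 ∼_; dia to infixr 8 ◇_)

  private
    at : Carrier → Carrier → Carrier → ℕ → Carrier
    at a b c 0             = a
    at a b c 1             = b
    at a b c (suc (suc _)) = c

  booleanAlgebra : BooleanAlgebra 0ℓ 0ℓ
  booleanAlgebra = record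
    { _≈_ = _≡_ ; _∨_ = _∨_ ; _∧_ = _∧_ ; ¬_ = ∼_ ; ⊤ = ⊤ ; ⊥ = ⊥
    ; isBooleanAlgebra = record
      { isDistributiveLattice = record
        { isLattice = record
          { isEquivalence = isEquivalence
          ; ∨-comm     = ∨-comm
          ; ∨-assoc    = λ a b c → isCA Defs.∨-assoc (at a b c)
          ; ∨-cong     = cong₂ _∨_
          ; ∧-comm     = ∧-comm
          ; ∧-assoc    = λ a b c → isCA Defs.∧-assoc (at a b c)
          ; ∧-cong     = cong₂ _∧_
          ; absorptive = (λ a b → isCA ∨-absorb (at a b a)) , (λ a b → isCA ∧-absorb (at a b a))
          }
        ; ∨-distrib-∧ = comm∧distrˡ⇒distr (cong₂ _∧_) ∨-comm (λ a b c → isCA ∨-distr (at a b c))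
        ; ∧-distrib-∨ = comm∧distrˡ⇒distr (cong₂ _∨_) ∧-comm (λ a b c → isCA ∧-distr (at a b c))
        }
      ; ∨-complement = comm∧invʳ⇒inv ∨-comm (λ a → isCA ∨-compl (at a a a))
      ; ∧-complement = comm∧invʳ⇒inv ∧-comm (λ a → isCA ∧-compl (at a a a))
      ; ¬-cong       = cong ∼_
      }
    }
    where
    ∨-comm : ∀ a b → a ∨ b ≡ b ∨ a
    ∨-comm a b = isCA Defs.∨-comm (at a b a)
    ∧-comm : ∀ a b → a ∧ b ≡ b ∧ a
    ∧-comm a b = isCA Defs.∧-comm (at a b a)

  open BooleanAlgebra booleanAlgebra public
    using ( ∨-comm; ∧-comm; ∨-assoc; ∧-assoc; ∨-absorbs-∧; ∧-absorbs-∨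
          ; ∨-distribˡ-∧; ∧-distribˡ-∨; ∧-distribʳ-∨; ∨-complementʳ; ∧-complementʳ; ∧-complementˡ)
  open BooleanAlgebraProperties booleanAlgebra public
    using ( ∧-identityˡ; ∧-identityʳ; ∨-identityʳ; ∧-zeroˡ; ∧-zeroʳ; ∨-zeroˡ; ∨-zeroʳ
          ; ∧-idem; ∨-idem; ∨-identityˡ; deMorgan₁; deMorgan₂; ¬-involutive; ¬⊥≈⊤; ¬⊤≈⊥)

  ◇-⊥ : ◇ ⊥ ≡ ⊥
  ◇-⊥ = isCA ◇-zero (at ⊥ ⊥ ⊥)

  ◇-∨ : ∀ a b → ◇ (a ∨ b) ≡ ◇ a ∨ ◇ b
  ◇-∨ a b = isCA ◇-join (at a b a)

  ◇-idem : ∀ a → ◇ ◇ a ≡ ◇ a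
  ◇-idem a = isCA Defs.◇-idem (at a a a)

  infix 4 _≤_

  _≤_ : Carrier → Carrier → Set
  a ≤ b = a ∨ b ≡ b

  ≤-refl : ∀ {a} → a ≤ a
  ≤-refl {a} = ∨-idem a

  ≤-reflexive : ∀ {a b} → a ≡ b → a ≤ b
  ≤-reflexive refl = ≤-refl

  ≤-trans : ∀ {a b c} → a ≤ b → b ≤ c → a ≤ c
  ≤-trans {a} {b} {c} a≤b b≤c = begin
    a ∨ c       ≡⟨ cong (a ∨_) (sym b≤c) ⟩
    a ∨ b ∨ c   ≡⟨ sym (∨-assoc a b c) ⟩
    (a ∨ b) ∨ c ≡⟨ cong (_∨ c) a≤b ⟩
    b ∨ c       ≡⟨ b≤c ⟩
    c           ∎
    where open ≡-Reasoning

  ≤-antisym : ∀ {a b} → a ≤ b → b ≤ a → a ≡ b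
  ≤-antisym {a} {b} a≤b b≤a = trans (sym b≤a) (trans (∨-comm b a) a≤b)

  x∧y≤x : ∀ a b → a ∧ b ≤ a
  x∧y≤x a b = trans (∨-comm (a ∧ b) a) (∨-absorbs-∧ a b)

  x∧y≤y : ∀ a b → a ∧ b ≤ b
  x∧y≤y a b = trans (cong (_∨ b) (∧-comm a b)) (x∧y≤x b a)

  ∧-greatest : ∀ {a b c} → a ≤ b → a ≤ c → a ≤ b ∧ c
  ∧-greatest {a} {b} {c} a≤b a≤c = trans (∨-distribˡ-∧ a b c) (cong₂ _∧_ a≤b a≤c)

  ≤⇒∧≡ : ∀ {a b} → a ≤ b → a ∧ b ≡ a
  ≤⇒∧≡ {a} {b} a≤b = trans (cong (a ∧_) (sym a≤b)) (∧-absorbs-∨ a b)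

  ∼-antitone : ∀ {a b} → a ≤ b → ∼ b ≤ ∼ a
  ∼-antitone {a} {b} a≤b =
    trans (sym (deMorgan₁ b a)) (cong ∼_ (trans (∧-comm b a) (≤⇒∧≡ a≤b)))

  ≤∼⇒∧≡⊥ : ∀ {a b} → b ≤ ∼ a → a ∧ b ≡ ⊥
  ≤∼⇒∧≡⊥ {a} {b} b≤∼a = begin
    a ∧ b         ≡⟨ cong (a ∧_) (sym (≤⇒∧≡ b≤∼a)) ⟩
    a ∧ b ∧ ∼ a   ≡⟨ cong (a ∧_) (∧-comm b (∼ a)) ⟩
    a ∧ ∼ a ∧ b   ≡⟨ sym (∧-assoc a (∼ a) b) ⟩
    (a ∧ ∼ a) ∧ b ≡⟨ cong (_∧ b) (∧-complementʳ a) ⟩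
    ⊥ ∧ b         ≡⟨ ∧-zeroˡ b ⟩
    ⊥             ∎
    where open ≡-Reasoning

  ◇-extensive : ∀ a → a ≤ ◇ a
  ◇-extensive a = isCA ◇-infl (at a a a)

  ◇-monotone : ∀ {a b} → a ≤ b → ◇ a ≤ ◇ b
  ◇-monotone {a} {b} a≤b = trans (sym (◇-∨ a b)) (cong ◇_ a≤b)

  infix 4 _≈[_]_

  _≈[_]_ : Carrier → Carrier → Carrier → Set
  a ≈[ d ] b = d ∧ a ≡ d ∧ b

  ≈[]-∨ : ∀ {d a a′ b b′} → a ≈[ d ] a′ → b ≈[ d ] b′ → a ∨ b ≈[ d ] a′ ∨ b′
  ≈[]-∨ {d} {a} {a′} {b} {b′} a≈a′ b≈b′ =
    trans (∧-distribˡ-∨ d a b) (trans (cong₂ _∨_ a≈a′ b≈b′) (sym (∧-distribˡ-∨ d a′ b′)))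

  ≈[]-∧ : ∀ {d a a′ b b′} → a ≈[ d ] a′ → b ≈[ d ] b′ → a ∧ b ≈[ d ] a′ ∧ b′
  ≈[]-∧ {d} {a} {a′} {b} {b′} a≈a′ b≈b′ = begin
    d ∧ a ∧ b     ≡⟨ sym (∧-assoc d a b) ⟩
    (d ∧ a) ∧ b   ≡⟨ cong (_∧ b) a≈a′ ⟩
    (d ∧ a′) ∧ b  ≡⟨ cong (_∧ b) (∧-comm d a′) ⟩
    (a′ ∧ d) ∧ b  ≡⟨ ∧-assoc a′ d b ⟩
    a′ ∧ d ∧ b    ≡⟨ cong (a′ ∧_) b≈b′ ⟩
    a′ ∧ d ∧ b′   ≡⟨ sym (∧-assoc a′ d b′) ⟩
    (a′ ∧ d) ∧ b′ ≡⟨ cong (_∧ b′) (∧-comm a′ d) ⟩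
    (d ∧ a′) ∧ b′ ≡⟨ ∧-assoc d a′ b′ ⟩
    d ∧ a′ ∧ b′   ∎
    where open ≡-Reasoning

  ≈[]-∼ : ∀ {d a a′} → a ≈[ d ] a′ → ∼ a ≈[ d ] ∼ a′
  ≈[]-∼ {d} {a} {a′} a≈a′ =
    trans (sym (∧∼-relative a)) (trans (cong (λ x → d ∧ ∼ x) a≈a′) (∧∼-relative a′))
    where
    open ≡-Reasoning
    ∧∼-relative : ∀ x → d ∧ ∼ (d ∧ x) ≡ d ∧ ∼ x
    ∧∼-relative x = begin
      d ∧ ∼ (d ∧ x)           ≡⟨ cong (d ∧_) (deMorgan₁ d x) ⟩
      d ∧ (∼ d ∨ ∼ x)         ≡⟨ ∧-distribˡ-∨ d (∼ d) (∼ x) ⟩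
      (d ∧ ∼ d) ∨ (d ∧ ∼ x)   ≡⟨ cong (_∨ d ∧ ∼ x) (∧-complementʳ d) ⟩
      ⊥ ∨ (d ∧ ∼ x)           ≡⟨ ∨-identityˡ (d ∧ ∼ x) ⟩
      d ∧ ∼ x                 ∎

  ≈[]-weakenʳ : ∀ {d e a b} → a ≈[ d ] b → a ≈[ e ∧ d ] b
  ≈[]-weakenʳ {d} {e} {a} {b} a≈b =
    trans (∧-assoc e d a) (trans (cong (e ∧_) a≈b) (sym (∧-assoc e d b)))

  ≈[]-weakenˡ : ∀ {d e a b} → a ≈[ d ] b → a ≈[ d ∧ e ] b
  ≈[]-weakenˡ {d} {e} {a} {b} a≈b =
    trans (cong (_∧ a) (∧-comm d e)) (trans (≈[]-weakenʳ a≈b) (cong (_∧ b) (∧-comm e d)))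

  ∧-split : ∀ c d → d ≡ d ∧ c ∨ d ∧ ∼ c
  ∧-split c d = begin
    d                 ≡⟨ sym (∧-identityʳ d) ⟩
    d ∧ ⊤             ≡⟨ cong (d ∧_) (sym (∨-complementʳ c)) ⟩
    d ∧ (c ∨ ∼ c)     ≡⟨ ∧-distribˡ-∨ d c (∼ c) ⟩
    d ∧ c ∨ d ∧ ∼ c   ∎
    where open ≡-Reasoning

  ≈[]-split : ∀ c {d a b} → a ≈[ d ∧ c ] b → a ≈[ d ∧ ∼ c ] b → a ≈[ d ] b
  ≈[]-split c {d} {a} {b} a≈b₁ a≈b₂ = begin
    d ∧ a                           ≡⟨ cong (_∧ a) split ⟩
    ((d ∧ c) ∨ (d ∧ ∼ c)) ∧ a       ≡⟨ ∧-distribʳ-∨ a (d ∧ c) (d ∧ ∼ c) ⟩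
    (d ∧ c) ∧ a ∨ (d ∧ ∼ c) ∧ a     ≡⟨ cong₂ _∨_ a≈b₁ a≈b₂ ⟩
    (d ∧ c) ∧ b ∨ (d ∧ ∼ c) ∧ b     ≡⟨ sym (∧-distribʳ-∨ b (d ∧ c) (d ∧ ∼ c)) ⟩
    ((d ∧ c) ∨ (d ∧ ∼ c)) ∧ b       ≡⟨ cong (_∧ b) (sym split) ⟩
    d ∧ b                           ∎
    where
    open ≡-Reasoning
    split = ∧-split c d

  ≈[∧]-⊤ : ∀ d a → a ≈[ d ∧ a ] ⊤
  ≈[∧]-⊤ d a = begin
    (d ∧ a) ∧ a ≡⟨ ∧-assoc d a a ⟩
    d ∧ a ∧ a   ≡⟨ cong (d ∧_) (∧-idem a) ⟩
    d ∧ a       ≡⟨ sym (∧-identityʳ (d ∧ a)) ⟩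
    (d ∧ a) ∧ ⊤ ∎
    where open ≡-Reasoning

  ≈[∧∼]-⊥ : ∀ d a → a ≈[ d ∧ ∼ a ] ⊥
  ≈[∧∼]-⊥ d a = begin
    (d ∧ ∼ a) ∧ a ≡⟨ ∧-assoc d (∼ a) a ⟩
    d ∧ ∼ a ∧ a   ≡⟨ cong (d ∧_) (∧-complementˡ a) ⟩
    d ∧ ⊥         ≡⟨ ∧-zeroʳ d ⟩
    ⊥             ≡⟨ sym (∧-zeroʳ (d ∧ ∼ a)) ⟩
    (d ∧ ∼ a) ∧ ⊥ ∎
    where open ≡-Reasoning

  Closed Open Dense : Carrier → Set
  Closed a = ◇ a ≡ a
  Open a   = Closed (∼ a)
  Dense a  = ◇ a ≡ ⊤

  DenseOpen : Carrier → Set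
  DenseOpen a = Dense a × Open a

  closed-∧ : ∀ {a b} → Closed a → Closed b → Closed (a ∧ b)
  closed-∧ {a} {b} a-closed b-closed = ≤-antisym
    (∧-greatest (≤-trans (◇-monotone (x∧y≤x a b)) (≤-reflexive a-closed))
                (≤-trans (◇-monotone (x∧y≤y a b)) (≤-reflexive b-closed)))
    (◇-extensive (a ∧ b))

  open-∧ : ∀ {a b} → Open a → Open b → Open (a ∧ b)
  open-∧ {a} {b} a-open b-open = begin
    ◇ ∼ (a ∧ b)       ≡⟨ cong ◇_ (deMorgan₁ a b) ⟩
    ◇ (∼ a ∨ ∼ b)     ≡⟨ ◇-∨ (∼ a) (∼ b) ⟩
    ◇ ∼ a ∨ ◇ ∼ b     ≡⟨ cong₂ _∨_ a-open b-open ⟩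
    ∼ a ∨ ∼ b         ≡⟨ sym (deMorgan₁ a b) ⟩
    ∼ (a ∧ b)         ∎
    where open ≡-Reasoning

  dense-closed-≈⊤ : ∀ {d a} → Dense d → Closed a → a ≈[ d ] ⊤ → a ≡ ⊤
  dense-closed-≈⊤ {d} {a} d-dense a-closed a≈⊤ = begin
    a           ≡⟨ sym a-closed ⟩
    ◇ a         ≡⟨ sym (◇-monotone d≤a) ⟩
    ◇ d ∨ ◇ a   ≡⟨ cong (_∨ ◇ a) d-dense ⟩
    ⊤ ∨ ◇ a     ≡⟨ ∨-zeroˡ (◇ a) ⟩
    ⊤           ∎
    where
    open ≡-Reasoning
    d≤a : d ≤ a
    d≤a = trans (cong (_∨ a) (sym (trans a≈⊤ (∧-identityʳ d)))) (x∧y≤y d a)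

  denseOpen-⊤ : DenseOpen ⊤
  denseOpen-⊤ = ≤-antisym (∨-zeroʳ (◇ ⊤)) (◇-extensive ⊤)
              , trans (cong ◇_ ¬⊤≈⊥) (trans ◇-⊥ (sym ¬⊤≈⊥))

  ◇≈[open] : ∀ {a} b → Open a → ◇ (a ∧ b) ≈[ a ] ◇ b
  ◇≈[open] {a} b a-open = sym (begin
    a ∧ ◇ b                          ≡⟨ cong (λ x → a ∧ ◇ x) (∧-split a b) ⟩
    a ∧ ◇ (b ∧ a ∨ b ∧ ∼ a)          ≡⟨ cong (a ∧_) (◇-∨ (b ∧ a) (b ∧ ∼ a)) ⟩
    a ∧ (◇ (b ∧ a) ∨ ◇ (b ∧ ∼ a))    ≡⟨ ∧-distribˡ-∨ a (◇ (b ∧ a)) (◇ (b ∧ ∼ a)) ⟩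
    a ∧ ◇ (b ∧ a) ∨ a ∧ ◇ (b ∧ ∼ a)  ≡⟨ cong₂ (λ x y → a ∧ ◇ x ∨ y) (∧-comm b a) outside ⟩
    a ∧ ◇ (a ∧ b) ∨ ⊥                ≡⟨ ∨-identityʳ (a ∧ ◇ (a ∧ b)) ⟩
    a ∧ ◇ (a ∧ b)                    ∎)
    where
    open ≡-Reasoning
    outside : a ∧ ◇ (b ∧ ∼ a) ≡ ⊥
    outside = ≤∼⇒∧≡⊥ (≤-trans (◇-monotone (x∧y≤y b (∼ a))) (≤-reflexive a-open))

  denseOpen-∧ : ∀ {a b} → DenseOpen a → DenseOpen b → DenseOpen (a ∧ b)
  denseOpen-∧ {a} {b} (a-dense , a-open) (b-dense , b-open) =
    dense-closed-≈⊤ a-dense (◇-idem (a ∧ b)) (trans (◇≈[open] b a-open) (cong (a ∧_) b-dense))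
    , open-∧ a-open b-open

  infixr 8 □_

  □_ : Carrier → Carrier
  □ a = ∼ ◇ ∼ a

  □≤ : ∀ a → □ a ≤ a
  □≤ a = ≤-trans (∼-antitone (◇-extensive (∼ a))) (≤-reflexive (¬-involutive a))

  -- □ a ∨ □ ∼ a: where a is locally constant.
  decided : Carrier → Carrier
  decided a = □ a ∨ ∼ ◇ a

  decided-open : ∀ a → Open (decided a)
  decided-open a =
    trans (cong ◇_ ∼decided) (trans (closed-∧ (◇-idem (∼ a)) (◇-idem a)) (sym ∼decided))
    where
    ∼decided : ∼ decided a ≡ ◇ ∼ a ∧ ◇ a
    ∼decided = trans (deMorgan₂ (□ a) (∼ ◇ a)) (cong₂ _∧_ (¬-involutive _) (¬-involutive _))

  decided-∧ : ∀ {a b} → □ a ≤ b → b ≤ ◇ a → decided a ∧ b ≡ □ a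
  decided-∧ {a} {b} □a≤b b≤◇a = begin
    (□ a ∨ ∼ ◇ a) ∧ b       ≡⟨ ∧-distribʳ-∨ b (□ a) (∼ ◇ a) ⟩
    □ a ∧ b ∨ ∼ ◇ a ∧ b     ≡⟨ cong₂ _∨_ (≤⇒∧≡ □a≤b) outside ⟩
    □ a ∨ ⊥                 ≡⟨ ∨-identityʳ (□ a) ⟩
    □ a                     ∎
    where
    open ≡-Reasoning
    outside : ∼ ◇ a ∧ b ≡ ⊥
    outside = ≤∼⇒∧≡⊥ (≤-trans b≤◇a (≤-reflexive (sym (¬-involutive (◇ a)))))

  ◇≈[decided] : ∀ a → ◇ a ≈[ decided a ] a
  ◇≈[decided] a = trans (decided-∧ (≤-trans (□≤ a) (◇-extensive a)) ≤-refl)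
                        (sym (decided-∧ (□≤ a) (◇-extensive a)))

  decidedSubterms : (ℕ → Carrier) → Term → Carrier
  decidedSubterms ρ (var i)  = ⊤
  decidedSubterms ρ ⊥'       = ⊤
  decidedSubterms ρ ⊤'       = ⊤
  decidedSubterms ρ (s ∨' t) = decidedSubterms ρ s ∧ decidedSubterms ρ t
  decidedSubterms ρ (s ∧' t) = decidedSubterms ρ s ∧ decidedSubterms ρ t
  decidedSubterms ρ (¬' s)   = decidedSubterms ρ s
  decidedSubterms ρ (◇' s)   = decidedSubterms ρ s ∧ decided (eval A ρ s)

  eval≈[]discrete : ∀ ρ t → eval A ρ t ≈[ decidedSubterms ρ t ] eval (discrete A) ρ t
  eval≈[]discrete ρ (var i)  = refl
  eval≈[]discrete ρ ⊥'       = refl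
  eval≈[]discrete ρ ⊤'       = refl
  eval≈[]discrete ρ (s ∨' t) = ≈[]-∨ (≈[]-weakenˡ (eval≈[]discrete ρ s)) (≈[]-weakenʳ (eval≈[]discrete ρ t))
  eval≈[]discrete ρ (s ∧' t) = ≈[]-∧ (≈[]-weakenˡ (eval≈[]discrete ρ s)) (≈[]-weakenʳ (eval≈[]discrete ρ t))
  eval≈[]discrete ρ (¬' s)   = ≈[]-∼ (eval≈[]discrete ρ s)
  eval≈[]discrete ρ (◇' s)   =
    trans (≈[]-weakenʳ (◇≈[decided] (eval A ρ s))) (≈[]-weakenˡ (eval≈[]discrete ρ s))

  discrete-cong : ∀ {d} ρ σ t → (∀ i → i ∈ vars t → ρ i ≈[ d ] σ i) →
                  eval (discrete A) ρ t ≈[ d ] eval (discrete A) σ t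
  discrete-cong ρ σ (var i)  ρ≈σ = ρ≈σ i (here refl)
  discrete-cong ρ σ ⊥'       ρ≈σ = refl
  discrete-cong ρ σ ⊤'       ρ≈σ = refl
  discrete-cong ρ σ (s ∨' t) ρ≈σ =
    ≈[]-∨ (discrete-cong ρ σ s (λ i → ρ≈σ i ∘ ∈-++⁺ˡ))
          (discrete-cong ρ σ t (λ i → ρ≈σ i ∘ ∈-++⁺ʳ (vars s)))
  discrete-cong ρ σ (s ∧' t) ρ≈σ =
    ≈[]-∧ (discrete-cong ρ σ s (λ i → ρ≈σ i ∘ ∈-++⁺ˡ))
          (discrete-cong ρ σ t (λ i → ρ≈σ i ∘ ∈-++⁺ʳ (vars s)))
  discrete-cong ρ σ (¬' s)   ρ≈σ = ≈[]-∼ (discrete-cong ρ σ s ρ≈σ)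
  discrete-cong ρ σ (◇' s)   ρ≈σ = discrete-cong ρ σ s ρ≈σ

  embed : Bool → Carrier
  embed true  = ⊤
  embed false = ⊥

  embed-homomorphism : IsHomomorphism 𝟚 (discrete A) embed
  embed-homomorphism = record
    { zero-hom = refl
    ; one-hom  = refl
    ; join-hom = λ { true b → sym (∨-zeroˡ (embed b)) ; false b → sym (∨-identityˡ (embed b)) }
    ; meet-hom = λ { true b → sym (∧-identityˡ (embed b)) ; false b → sym (∧-zeroˡ (embed b)) }
    ; neg-hom  = λ { true → sym ¬⊤≈⊥ ; false → sym ¬⊥≈⊤ }
    ; dia-hom  = λ _ → refl
    }

  -- Shannon expansion: d is split along ρ k for each k ∈ L until every variable of t is
  -- Boolean relative to d.
  tautology-≈[] : ∀ t → Tautology t → ∀ ρ L d v →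
                  (∀ i → i ∈ vars t → i ∈ L ⊎ ρ i ≈[ d ] embed (v i)) →
                  eval (discrete A) ρ t ≈[ d ] ⊤
  tautology-≈[] t taut ρ [] d v valued = begin
    d ∧ eval (discrete A) ρ t           ≡⟨ discrete-cong ρ (embed ∘ v) t (λ i → [ (λ ()) , id ]′ ∘ valued i) ⟩
    d ∧ eval (discrete A) (embed ∘ v) t ≡⟨ cong (d ∧_) (sym (eval-homomorphic embed-homomorphism v t)) ⟩
    d ∧ embed (eval 𝟚 v t)              ≡⟨ cong (λ b → d ∧ embed b) (taut v) ⟩
    d ∧ ⊤                               ∎
    where open ≡-Reasoning
  tautology-≈[] t taut ρ (k ∷ L) d v valued = ≈[]-split (ρ k)
    (tautology-≈[] t taut ρ L (d ∧ ρ k) (update v k true) (revalue true (≈[∧]-⊤ d (ρ k))))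
    (tautology-≈[] t taut ρ L (d ∧ ∼ ρ k) (update v k false) (revalue false (≈[∧∼]-⊥ d (ρ k))))
    where
    revalue : ∀ {e} b → ρ k ≈[ d ∧ e ] embed b →
              ∀ i → i ∈ vars t → i ∈ L ⊎ ρ i ≈[ d ∧ e ] embed (update v k b i)
    revalue b ρk≈b i i∈t with i ≟ k | valued i i∈t
    ... | yes refl | _                  = inj₂ ρk≈b
    ... | no i≢k   | inj₁ (here i≡k)    = contradiction i≡k i≢k
    ... | no _     | inj₁ (there i∈L)   = inj₁ i∈L
    ... | no _     | inj₂ ρi≈vi         = inj₂ (≈[]-weakenˡ ρi≈vi)

  tautology-discrete : ∀ t → Tautology t → ∀ ρ → eval (discrete A) ρ t ≡ ⊤
  tautology-discrete t taut ρ =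
    trans (sym (∧-identityˡ _))
          (trans (tautology-≈[] t taut ρ (vars t) ⊤ (λ _ → true) (λ _ → inj₁)) (∧-identityˡ ⊤))

  module McKinsey (mckinsey : ∀ a → ∼ □ ◇ a ∨ ◇ □ a ≡ ⊤) where

    decided-dense : ∀ a → Dense (decided a)
    decided-dense a = begin
      ◇ (□ a ∨ ∼ ◇ a)   ≡⟨ ◇-∨ (□ a) (∼ ◇ a) ⟩
      ◇ □ a ∨ ◇ ∼ ◇ a   ≡⟨ ∨-comm (◇ □ a) (◇ ∼ ◇ a) ⟩
      ◇ ∼ ◇ a ∨ ◇ □ a   ≡⟨ cong (_∨ ◇ □ a) (sym (¬-involutive (◇ ∼ ◇ a))) ⟩
      ∼ □ ◇ a ∨ ◇ □ a   ≡⟨ mckinsey a ⟩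
      ⊤                 ∎
      where open ≡-Reasoning

    decidedSubterms-denseOpen : ∀ ρ t → DenseOpen (decidedSubterms ρ t)
    decidedSubterms-denseOpen ρ (var i)  = denseOpen-⊤
    decidedSubterms-denseOpen ρ ⊥'       = denseOpen-⊤
    decidedSubterms-denseOpen ρ ⊤'       = denseOpen-⊤
    decidedSubterms-denseOpen ρ (s ∨' t) =
      denseOpen-∧ (decidedSubterms-denseOpen ρ s) (decidedSubterms-denseOpen ρ t)
    decidedSubterms-denseOpen ρ (s ∧' t) =
      denseOpen-∧ (decidedSubterms-denseOpen ρ s) (decidedSubterms-denseOpen ρ t)
    decidedSubterms-denseOpen ρ (¬' s)   = decidedSubterms-denseOpen ρ s
    decidedSubterms-denseOpen ρ (◇' s)   =
      denseOpen-∧ (decidedSubterms-denseOpen ρ s) (decided-dense (eval A ρ s) , decided-open (eval A ρ s))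

    closed-tautology : ∀ ρ t → Closed (eval A ρ t) → Tautology t → eval A ρ t ≡ ⊤
    closed-tautology ρ t closed taut =
      dense-closed-≈⊤ (proj₁ (decidedSubterms-denseOpen ρ t)) closed
        (trans (eval≈[]discrete ρ t) (cong (decidedSubterms ρ t ∧_) (tautology-discrete t taut ρ)))

closed-tautology : ∀ {Σ} t → McKinsey Σ → Tautology t → Σ ⊫ ◇' t ≈ t → Σ ⊫ t ≈ ⊤'
closed-tautology t mckinsey taut t-closed A A∈Σ ρ =
  McKinsey.closed-tautology (λ a → mckinsey A A∈Σ (λ _ → a)) ρ t (t-closed A A∈Σ ρ) taut
  where open ClosureAlgebra A (proj₁ A∈Σ)

at-p at-q : Alg.Carrier B2²⊕1 → Bool
at-p (_ , p , _) = p
at-q (_ , _ , q) = q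

at-p-homomorphism : IsHomomorphism B2²⊕1 𝟚 at-p
at-p-homomorphism = record
  { zero-hom = refl ; one-hom = refl ; join-hom = λ _ _ → refl
  ; meet-hom = λ _ _ → refl ; neg-hom = λ _ → refl ; dia-hom = λ _ → refl }

at-q-homomorphism : IsHomomorphism B2²⊕1 𝟚 at-q
at-q-homomorphism = record
  { zero-hom = refl ; one-hom = refl ; join-hom = λ _ _ → refl
  ; meet-hom = λ _ _ → refl ; neg-hom = λ _ → refl ; dia-hom = λ _ → refl }

-- 2²⊕1 is connected: a clopen up- and down-set contains both maximal points or neither.
B2²⊕1-clopen⇒at-p≡at-q : ∀ x → Alg.dia B2²⊕1 x ≡ x →
                         Alg.dia B2²⊕1 (Alg.neg B2²⊕1 x) ≡ Alg.neg B2²⊕1 x → at-p x ≡ at-q x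
B2²⊕1-clopen⇒at-p≡at-q (_     , true  , true ) _  _  = refl
B2²⊕1-clopen⇒at-p≡at-q (_     , false , false) _  _  = refl
B2²⊕1-clopen⇒at-p≡at-q (false , true  , false) () _
B2²⊕1-clopen⇒at-p≡at-q (true  , true  , false) _  ()
B2²⊕1-clopen⇒at-p≡at-q (false , false , true ) () _
B2²⊕1-clopen⇒at-p≡at-q (true  , false , true ) _  ()

clopen-constant : ∀ {Σ} t → B2²⊕1 ∈V Σ → Σ ⊫ ◇' t ≈ t → Σ ⊫ ◇' (¬' t) ≈ (¬' t) →
                  ∀ v w → eval 𝟚 v t ≡ eval 𝟚 w t
clopen-constant t B∈Σ t-closed t-open v w = begin
  eval 𝟚 v t             ≡⟨ sym (eval-homomorphic at-p-homomorphism ρ t) ⟩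
  at-p (eval B2²⊕1 ρ t)  ≡⟨ B2²⊕1-clopen⇒at-p≡at-q _ (t-closed B2²⊕1 B∈Σ ρ) (t-open B2²⊕1 B∈Σ ρ) ⟩
  at-q (eval B2²⊕1 ρ t)  ≡⟨ eval-homomorphic at-q-homomorphism ρ t ⟩
  eval 𝟚 w t             ∎
  where
  open ≡-Reasoning
  ρ : ℕ → Alg.Carrier B2²⊕1
  ρ i = false , v i , w i

clopen-trivial : ∀ {Σ} t → McKinsey Σ → B2²⊕1 ∈V Σ → Σ ⊫ ◇' t ≈ t → Σ ⊫ ◇' (¬' t) ≈ (¬' t) →
                 (Σ ⊫ t ≈ ⊤') ⊎ (Σ ⊫ (¬' t) ≈ ⊤')
clopen-trivial {Σ} t mckinsey B∈Σ t-closed t-open = by-value (eval 𝟚 (λ _ → false) t) refl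
  where
  constant : ∀ v → eval 𝟚 v t ≡ eval 𝟚 (λ _ → false) t
  constant v = clopen-constant t B∈Σ t-closed t-open v (λ _ → false)
  by-value : ∀ b → eval 𝟚 (λ _ → false) t ≡ b → (Σ ⊫ t ≈ ⊤') ⊎ (Σ ⊫ (¬' t) ≈ ⊤')
  by-value true  value =
    inj₁ (closed-tautology t mckinsey (λ v → trans (constant v) value) t-closed)
  by-value false value =
    inj₂ (closed-tautology (¬' t) mckinsey (λ v → cong not (trans (constant v) value)) t-open)

module _ {ΣU ΣW : Identities} (ι : EmbedsInto (JoinTh ΣU ΣW)) where

  open EmbedsInto ι
  open F²

  image-closed : ∀ E → ◆ E ≡ E → ΣU ⊫ (◇' f E) ≈ f E
  image-closed E E-closed A A∈U ρ =
    trans (sym (proj₁ (pres-◇ E) A A∈U ρ)) (cong (λ X → eval A ρ (f X)) E-closed)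

  image-open : ∀ E → ◆ (∁ E) ≡ ∁ E → ΣU ⊫ (◇' (¬' f E)) ≈ (¬' f E)
  image-open E E-open A A∈U ρ =
    trans (cong (Alg.dia A) (sym complement)) (trans (image-closed (∁ E) E-open A A∈U ρ) complement)
    where
    complement = proj₁ (pres-¬ E) A A∈U ρ

  image-above-⊤ : ∀ {E X} → ΣU ⊫ f E ≈ ⊤' → E ⊔ X ≡ X → ΣU ⊫ f X ≈ f 𝟙
  image-above-⊤ {E} {X} fE≈⊤ E≤X A A∈U ρ = begin
    eval A ρ (f X)                          ≡⟨ cong (λ Y → eval A ρ (f Y)) (sym E≤X) ⟩
    eval A ρ (f (E ⊔ X))                    ≡⟨ proj₁ (pres-∨ E X) A A∈U ρ ⟩
    eval A ρ (f E) ∨ eval A ρ (f X)         ≡⟨ cong (_∨ eval A ρ (f X)) (fE≈⊤ A A∈U ρ) ⟩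
    ⊤ ∨ eval A ρ (f X)                      ≡⟨ ∨-zeroˡ _ ⟩
    ⊤                                       ≡⟨ sym (proj₁ pres-1 A A∈U ρ) ⟩
    eval A ρ (f 𝟙)                          ∎
    where
    open ≡-Reasoning
    open ClosureAlgebra A (proj₁ A∈U) using (_∨_; ⊤; ∨-zeroˡ)

  monadic-dense-open : Monadic ΣW → ∀ {X} → ∁ (◆ (∁ X)) ≡ X → ◆ X ≡ 𝟙 → ΣW ⊫ f X ≈ f 𝟙
  monadic-dense-open monadic {X} X-open X-dense A A∈W ρ = begin
    u           ≡⟨ u-open ⟩
    □ u         ≡⟨ sym (monadic A A∈W (λ _ → u)) ⟩
    ◇ □ u       ≡⟨ cong ◇_ (sym u-open) ⟩
    ◇ u         ≡⟨ sym u-dense ⟩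
    eval A ρ (f 𝟙) ∎
    where
    open ≡-Reasoning
    open ClosureAlgebra A (proj₁ A∈W) using (◇_; ∼_; □_)
    u = eval A ρ (f X)
    u-open : u ≡ □ u
    u-open = begin
      u                           ≡⟨ cong (λ Y → eval A ρ (f Y)) (sym X-open) ⟩
      eval A ρ (f (∁ (◆ (∁ X))))  ≡⟨ proj₂ (pres-¬ (◆ (∁ X))) A A∈W ρ ⟩
      ∼ eval A ρ (f (◆ (∁ X)))    ≡⟨ cong ∼_ (proj₂ (pres-◇ (∁ X)) A A∈W ρ) ⟩
      ∼ ◇ eval A ρ (f (∁ X))      ≡⟨ cong (λ x → ∼ ◇ x) (proj₂ (pres-¬ X) A A∈W ρ) ⟩
      □ u                         ∎
    u-dense : eval A ρ (f 𝟙) ≡ ◇ u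
    u-dense = trans (cong (λ Y → eval A ρ (f Y)) (sym X-dense)) (proj₂ (pres-◇ X) A A∈W ρ)

  image-∁ : ∀ E → ΣU ⊫ (¬' f E) ≈ ⊤' → ΣU ⊫ f (∁ E) ≈ ⊤'
  image-∁ E ¬fE≈⊤ A A∈U ρ = trans (proj₁ (pres-¬ E) A A∈U ρ) (¬fE≈⊤ A A∈U ρ)

  dense-open-above-⊤ : Monadic ΣW → ∀ E X → ΣU ⊫ f E ≈ ⊤' → E ⊔ X ≡ X →
                       ∁ (◆ (∁ X)) ≡ X → ◆ X ≡ 𝟙 → X ≡ 𝟙
  dense-open-above-⊤ monadic E X fE≈⊤ E≤X X-open X-dense =
    inj X 𝟙 (image-above-⊤ fE≈⊤ E≤X , monadic-dense-open monadic X-open X-dense)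

-- In 4 the atom a = (true , false) is open with ◇ a = 1, so X₁ = (1 , a) and X₂ = (a , 1) are
-- dense open elements of 4², above E₀ and ∁ E₀ respectively.
E₀ X₁ X₂ : Four²
E₀ = (true , true) , (false , false)
X₁ = (true , true) , (true , false)
X₂ = (true , false) , (true , true)

lemma8p10 : (ΣU ΣW : Identities) → McKinsey ΣU → B2²⊕1 ∈V ΣU → Monadic ΣW
    → ¬ EmbedsInto (JoinTh ΣU ΣW)
lemma8p10 ΣU ΣW mckinsey B∈U monadic ι
  with clopen-trivial (EmbedsInto.f ι E₀) mckinsey B∈U (image-closed ι E₀ refl) (image-open ι E₀ refl)
... | inj₁ fE₀≈⊤ =
  case dense-open-above-⊤ ι monadic E₀ X₁ fE₀≈⊤ refl refl refl of λ ()
... | inj₂ ¬fE₀≈⊤ =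
  case dense-open-above-⊤ ι monadic (F².∁ E₀) X₂ (image-∁ ι E₀ ¬fE₀≈⊤) refl refl refl of λ ()
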